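{- Let $(U,d)$ be an ultra-metric space and, for $\epsilon\in[0,1]$ and $A\subseteq U$, let $I_\epsilon(A)=\{x\in U:\forall y\,(d(x,y)\le\epsilon\Rightarrow y\in A)\}$ and $C_\epsilon(A)=\{x\in U:\exists y\,(d(x,y)\le\epsilon\wedge y\in A)\}$. Then $I_\epsilon,C_\epsilon:\mathcal{P}(U)\to\mathcal{P}(U)$ satisfy, for all $A,B\subseteq U$ and all $\epsilon,\gamma\in[0,1]$: (i) $I_\epsilon(A)\subseteq I_\gamma(A)$ whenever $\epsilon\ge\gamma$; (ii) $I_\epsilon(I_\gamma(A))=I_{\max(\epsilon,\gamma)}(A)$; (iii) $I_0(A)=A$; (iv) $I_\epsilon(A)\subseteq A$; (v) $I_\epsilon(A\cap B)=I_\epsilon(A)\cap I_\epsilon(B)$; (vi) $A\subseteq C_\epsilon(A)$; (vii) $C_\epsilon(A)\subseteq I_\epsilon(C_\epsilon(A))$; (viii) $(I_\epsilon(A^C))^C=C_\epsilon(A)$, where $^C$ denotes complement in $U$; (ix) $A\subseteq I_\epsilon(C_\epsilon(A))$.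
   Context: An ultra-metric space is $(X,d)$ with $d:X\times X\to\mathbb{R}$ satisfying, for all $x,y,z$: $d(x,y)\ge0$, $d(x,y)=d(y,x)$, $d(x,y)=0$ iff $x=y$, and $d(x,z)\le\max\{d(x,y),d(y,z)\}$. -}

module Defs where

open import Level using (0ℓ)
open import Data.Product using (Σ; ∃; _×_; _,_)
open import Relation.Binary.PropositionalEquality using (_≡_)
open import Relation.Binary.Bundles using (TotalOrder)
open import Relation.Unary using (Pred)
import Algebra.Construct.NaturalChoice.Max as MaxOp

-- Distance values live in an arbitrary total order O (the paper uses ℝ,
-- which agda-stdlib lacks; ℝ with its usual order is an instance).
-- 𝟘 plays the role of the real number 0.
module _ (O : TotalOrder 0ℓ 0ℓ 0ℓ) where
  open TotalOrder O renaming (Carrier to V)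
  open MaxOp O using (_⊔_)

  record UltraMetric (𝟘 : V) (U : Set) : Set where
    field
      d        : U → U → V
      nonneg   : ∀ x y → 𝟘 ≤ d x y
      symm     : ∀ x y → d x y ≡ d y x
      zero⇒eq  : ∀ x y → d x y ≈ 𝟘 → x ≡ y
      eq⇒zero  : ∀ x y → x ≡ y → d x y ≈ 𝟘
      ultra    : ∀ x y z → d x z ≤ (d x y ⊔ d y z)

  InUnit : V → V → V → Set
  InUnit 𝟘 𝟙 ε = 𝟘 ≤ ε × ε ≤ 𝟙

  module _ {𝟘 : V} {U : Set} (M : UltraMetric 𝟘 U) where
    open UltraMetric M

    Int : V → Pred U 0ℓ → Pred U 0ℓ
    Int ε A x = ∀ y → d x y ≤ ε → A y

    Cl : V → Pred U 0ℓ → Pred U 0ℓ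
    Cl ε A x = ∃ λ y → d x y ≤ ε × A y

-- In an ultra-metric space every point of a closed ball is one of its
-- centres: d(y,z) ≤ max(d(y,x), d(x,z)).  Hence the ε-neighbourhood of any
-- set is ε-open (vii), and an ε-ball around a point of a γ-ball stays inside
-- the max(ε,γ)-ball, which gives I_ε ∘ I_γ = I_max(ε,γ) (ii).  The remaining
-- laws only use that d vanishes exactly on the diagonal, and (viii) is the
-- De Morgan duality ¬∀¬ = ∃, which needs excluded middle.
{-# OPTIONS --safe #-}
module Submission where

open import Defs
open import Level using (0ℓ)
open import Data.Product using (_×_; _,_; proj₁; proj₂)
open import Data.Sum using (inj₁; inj₂)
open import Relation.Binary.Bundles using (TotalOrder)
import Relation.Binary.PropositionalEquality as ≡
open import Function using (_∘′_)
open import Relation.Unary using (Pred; _⊆_; _≐_; _∩_; ∁)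
open import Axiom.ExcludedMiddle using (ExcludedMiddle)
open import Axiom.DoubleNegationElimination using (em⇒dne)
open import Algebra.Construct.NaturalChoice.Max using (_⊔_)
import Algebra.Construct.NaturalChoice.Max as Max

module _ {O : TotalOrder 0ℓ 0ℓ 0ℓ} {𝟘 : TotalOrder.Carrier O} {U : Set}
         (M : UltraMetric O 𝟘 U) where

  open TotalOrder O renaming (Carrier to V)
  open Max O using (⊔-sel; ⊔-lub; ⊔-mono-≤)
  open UltraMetric M

  private
    variable
      ε γ : V
      A B : Pred U 0ℓ

  d-refl-≤ : 𝟘 ≤ ε → ∀ x → d x x ≤ ε
  d-refl-≤ 0≤ε x = ≤-respˡ-≈ (Eq.sym (eq⇒zero x x ≡.refl)) 0≤ε

  Int-antitone : γ ≤ ε → Int O M ε A ⊆ Int O M γ A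
  Int-antitone γ≤ε x∈IεA y dxy≤γ = x∈IεA y (trans dxy≤γ γ≤ε)

  Int-mono : A ⊆ B → Int O M ε A ⊆ Int O M ε B
  Int-mono A⊆B x∈IεA y dxy≤ε = A⊆B (x∈IεA y dxy≤ε)

  Int-deflationary : 𝟘 ≤ ε → Int O M ε A ⊆ A
  Int-deflationary 0≤ε {x} x∈IεA = x∈IεA x (d-refl-≤ 0≤ε x)

  Int-𝟘-inflationary : A ⊆ Int O M 𝟘 A
  Int-𝟘-inflationary {A} {x} x∈A y dxy≤0 =
    ≡.subst A (zero⇒eq x y (antisym dxy≤0 (nonneg x y))) x∈A

  Int-𝟘 : Int O M 𝟘 A ≐ A
  Int-𝟘 = Int-deflationary refl , Int-𝟘-inflationary

  Int-Int⊆Int-⊔ : 𝟘 ≤ ε → 𝟘 ≤ γ →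
                  Int O M ε (Int O M γ A) ⊆ Int O M (_⊔_ O ε γ) A
  Int-Int⊆Int-⊔ {ε} {γ} 0≤ε 0≤γ with ⊔-sel ε γ
  ... | inj₁ ε⊔γ≈ε =
    Int-antitone (reflexive ε⊔γ≈ε) ∘′ Int-mono (Int-deflationary 0≤γ)
  ... | inj₂ ε⊔γ≈γ = Int-antitone (reflexive ε⊔γ≈γ) ∘′ Int-deflationary 0≤ε

  Int-⊔⊆Int-Int : Int O M (_⊔_ O ε γ) A ⊆ Int O M ε (Int O M γ A)
  Int-⊔⊆Int-Int {x = x} x∈I y dxy≤ε z dyz≤γ =
    x∈I z (trans (ultra x y z) (⊔-mono-≤ dxy≤ε dyz≤γ))

  Int-Int : 𝟘 ≤ ε → 𝟘 ≤ γ → Int O M ε (Int O M γ A) ≐ Int O M (_⊔_ O ε γ) A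
  Int-Int 0≤ε 0≤γ = Int-Int⊆Int-⊔ 0≤ε 0≤γ , Int-⊔⊆Int-Int

  Int-∩ : Int O M ε (A ∩ B) ≐ (Int O M ε A ∩ Int O M ε B)
  Int-∩ = (λ x∈I → Int-mono proj₁ x∈I , Int-mono proj₂ x∈I)
        , (λ (x∈IεA , x∈IεB) y dxy≤ε → x∈IεA y dxy≤ε , x∈IεB y dxy≤ε)

  Cl-inflationary : 𝟘 ≤ ε → A ⊆ Cl O M ε A
  Cl-inflationary 0≤ε {x} x∈A = x , d-refl-≤ 0≤ε x , x∈A

  Cl⊆Int-Cl : Cl O M ε A ⊆ Int O M ε (Cl O M ε A)
  Cl⊆Int-Cl {ε} {x = x} (z , dxz≤ε , z∈A) y dxy≤ε =
    z , trans (ultra y x z) (⊔-lub (≡.subst (_≤ ε) (symm x y) dxy≤ε) dxz≤ε) , z∈A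

  ∁-Int-∁ : ExcludedMiddle 0ℓ → ∁ (Int O M ε (∁ A)) ≐ Cl O M ε A
  ∁-Int-∁ em =
    (λ x∉I → em⇒dne em λ x∉Cl → x∉I λ y dxy≤ε y∈A → x∉Cl (y , dxy≤ε , y∈A))
    , λ (y , dxy≤ε , y∈A) x∈I → x∈I y dxy≤ε y∈A

proposition4 : (O : TotalOrder 0ℓ 0ℓ 0ℓ) → ExcludedMiddle 0ℓ →
    (𝟘 𝟙 : TotalOrder.Carrier O) → (U : Set) → (M : UltraMetric O 𝟘 U) →
    (A B : Pred U 0ℓ) → (ε γ : TotalOrder.Carrier O) →
    InUnit O 𝟘 𝟙 ε → InUnit O 𝟘 𝟙 γ →
      (TotalOrder._≤_ O γ ε → Int O M ε A ⊆ Int O M γ A)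
      × (Int O M ε (Int O M γ A) ≐ Int O M (_⊔_ O ε γ) A)
      × (Int O M 𝟘 A ≐ A)
      × (Int O M ε A ⊆ A)
      × (Int O M ε (A ∩ B) ≐ (Int O M ε A ∩ Int O M ε B))
      × (A ⊆ Cl O M ε A)
      × (Cl O M ε A ⊆ Int O M ε (Cl O M ε A))
      × (∁ (Int O M ε (∁ A)) ≐ Cl O M ε A)
      × (A ⊆ Int O M ε (Cl O M ε A))
proposition4 O em 𝟘 𝟙 U M A B ε γ (0≤ε , _) (0≤γ , _) =
    Int-antitone M
  , Int-Int M 0≤ε 0≤γ
  , Int-𝟘 M
  , Int-deflationary M 0≤ε
  , Int-∩ M
  , Cl-inflationary M 0≤ε
  , Cl⊆Int-Cl M
  , ∁-Int-∁ M em
  , Cl⊆Int-Cl M ∘′ Cl-inflationary M 0≤ε
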